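{- Let $n\ge1$ and let $E$ be the equivalence class of $12\cdots n$ under $\sim$ in $\mathfrak{S}_n$. For each sparse subset $S\subseteq[n-1]$ there is exactly one $w\in E$ with $D(w)=S$. Conversely, if $w\in E$ then $D(w)$ is sparse.
   Context: Two permutations $u,v\in\mathfrak{S}_n$ (words $a_1\cdots a_n$) satisfy $u\sim v$ if $v$ can be obtained from $u$ by a sequence of interchanges of adjacent entries differing by exactly $1$. For $w=a_1\cdots a_n$, the descent set is $D(w)=\{i: a_i>a_{i+1}\}\subseteq[n-1]$. A set of integers is sparse if it contains no two consecutive integers. $[n-1]=\{1,\dots,n-1\}$. -}

module Defs where

open import Data.Nat using (ℕ; zero; suc; _<?_)
open import Data.Fin using (Fin; toℕ; inject₁)
open import Data.Fin.Subset using (Subset; inside; outside; _∈_)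
open import Data.Vec using (Vec; []; _∷_; lookup; tabulate)
open import Data.Sum using (_⊎_)
open import Data.Product using (_×_)
open import Data.Bool using (if_then_else_)
open import Relation.Nullary using (¬_; does)
open import Relation.Binary.PropositionalEquality using (_≡_)
open import Relation.Binary.Construct.Closure.ReflexiveTransitive using (Star)

-- A word a₁ ⋯ aₙ, stored as a vector of natural numbers (values 1..n for permutations).
Word : ℕ → Set
Word n = Vec ℕ n

idWord : (n : ℕ) → Word n
idWord n = tabulate (λ i → suc (toℕ i))

DifferByOne : ℕ → ℕ → Set
DifferByOne a b = (a ≡ suc b) ⊎ (b ≡ suc a)

data Step : {n : ℕ} → Word n → Word n → Set where
  here  : ∀ {n} {a b : ℕ} {xs : Word n} →
          DifferByOne a b → Step (a ∷ b ∷ xs) (b ∷ a ∷ xs)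
  there : ∀ {n} {x : ℕ} {xs ys : Word n} →
          Step xs ys → Step (x ∷ xs) (x ∷ ys)

_∼_ : {n : ℕ} → Word n → Word n → Set
_∼_ = Star Step

InIdClass : {n : ℕ} → Word n → Set
InIdClass {n} w = idWord n ∼ w

-- Descent set of a word of length n = suc m, as a subset of [n-1] = [m]:
-- the element j : Fin m represents position i = toℕ j + 1, and
-- i ∈ D(w) iff a_i > a_{i+1}.
descentSet : {m : ℕ} → Word (suc m) → Subset m
descentSet {m} w =
  tabulate (λ j → if does (lookup w (Data.Fin.suc j) <? lookup w (inject₁ j))
                  then inside else outside)

Sparse : {m : ℕ} → Subset m → Set
Sparse {m} S = (j k : Fin m) → toℕ k ≡ suc (toℕ j) → ¬ (j ∈ S × k ∈ S)

-- A word of the class of 12⋯n is 12⋯n with some pairwise disjoint adjacent pairs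
-- (i, i+1) reversed; the reversed pairs sit exactly at the descents, so the descent
-- set is sparse and determines the word, and every sparse set arises.  Such words
-- are closed under the moves: apart from the pairs (i, i+1) and (i+1, i) themselves,
-- adjacent entries of such a word differ by at least 2, so a move can only reverse
-- an unreversed pair whose neighbours are unreversed, or restore a reversed pair.
module Submission where

open import Defs
open import Data.Nat using (ℕ; zero; suc; pred; _+_; _<_; _<?_)
open import Data.Nat.Properties using (+-suc; +-comm; n<1+n; <⇒≤; <-asym)
open import Data.Fin using (zero; suc; toℕ)
open import Data.Fin.Subset using (Subset; inside; outside; ⊥)
open import Data.Vec using ([]; _∷_; head; tabulate; here; there)
open import Data.Vec.Properties using (tabulate-cong)
open import Data.Product using (_×_; ∃!; Σ-syntax; _,_)
open import Data.Sum using (inj₁; inj₂)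
open import Data.Bool using (if_then_else_)
open import Data.Empty using (⊥-elim)
open import Relation.Nullary.Decidable using (dec-true; dec-false)
open import Relation.Nullary.Irrelevant using (Irrelevant)
open import Relation.Binary.PropositionalEquality
  using (_≡_; refl; sym; trans; cong; cong₂; subst)
open import Relation.Binary.Construct.Closure.ReflexiveTransitive
  using (ε; _◅_; gmap)

private
  variable
    m : ℕ
    S : Subset m

data SparseView : Subset m → Set where
  []                 : SparseView []
  outside∷_          : SparseView S → SparseView (outside ∷ S)
  [inside]           : SparseView (inside ∷ [])
  inside∷outside∷_   : SparseView S → SparseView (inside ∷ outside ∷ S)

sparseView-irrelevant : Irrelevant (SparseView S)
sparseView-irrelevant []                  []                   = refl
sparseView-irrelevant (outside∷ v)        (outside∷ v′)        =
  cong outside∷_ (sparseView-irrelevant v v′)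
sparseView-irrelevant [inside]            [inside]             = refl
sparseView-irrelevant (inside∷outside∷ v) (inside∷outside∷ v′) =
  cong inside∷outside∷_ (sparseView-irrelevant v v′)

∅-view : SparseView {m} ⊥
∅-view {zero}  = []
∅-view {suc m} = outside∷ ∅-view

sparse-tail : ∀ {x} → Sparse (x ∷ S) → Sparse S
sparse-tail sp j k e (j∈S , k∈S) = sp (suc j) (suc k) (cong suc e) (there j∈S , there k∈S)

sparse⇒view : (S : Subset m) → Sparse S → SparseView S
sparse⇒view []                     sp = []
sparse⇒view (outside ∷ S)          sp = outside∷ sparse⇒view S (sparse-tail sp)
sparse⇒view (inside ∷ [])          sp = [inside]
sparse⇒view (inside ∷ inside ∷ S)  sp = ⊥-elim (sp zero (suc zero) refl (here , there here))
sparse⇒view (inside ∷ outside ∷ S) sp =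
  inside∷outside∷ sparse⇒view S (sparse-tail (sparse-tail sp))

sparse-outside∷ : Sparse S → Sparse (outside ∷ S)
sparse-outside∷ sp zero    k       e  (() , _)
sparse-outside∷ sp (suc j) zero    ()
sparse-outside∷ sp (suc j) (suc k) e  (there j∈S , there k∈S) =
  sp j k (cong pred e) (j∈S , k∈S)

sparse-[inside] : Sparse (inside ∷ [])
sparse-[inside] zero zero ()

sparse-inside∷ : Sparse (outside ∷ S) → Sparse (inside ∷ outside ∷ S)
sparse-inside∷ sp zero    zero          ()
sparse-inside∷ sp zero    (suc zero)    e  (_ , there ())
sparse-inside∷ sp zero    (suc (suc k)) ()
sparse-inside∷ sp (suc j) zero          ()
sparse-inside∷ sp (suc j) (suc k)       e  (there j∈S , there k∈S) =
  sp j k (cong pred e) (j∈S , k∈S)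

view⇒sparse : SparseView S → Sparse S
view⇒sparse []                  = λ ()
view⇒sparse (outside∷ v)        = sparse-outside∷ (view⇒sparse v)
view⇒sparse [inside]            = sparse-[inside]
view⇒sparse (inside∷outside∷ v) = sparse-inside∷ (sparse-outside∷ (view⇒sparse v))

flipped : ℕ → SparseView {m} S → Word (suc m)
flipped k []                  = suc k ∷ []
flipped k (outside∷ v)        = suc k ∷ flipped (suc k) v
flipped k [inside]            = suc (suc k) ∷ suc k ∷ []
flipped k (inside∷outside∷ v) = suc (suc k) ∷ suc k ∷ flipped (suc (suc k)) v

flipped-∅ : ∀ k m → flipped k (∅-view {m}) ≡ tabulate (λ i → k + suc (toℕ i))
flipped-∅ k zero    = cong (_∷ []) (+-comm 1 k)
flipped-∅ k (suc m) = cong₂ _∷_ (+-comm 1 k)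
  (trans (flipped-∅ (suc k) m) (tabulate-cong (λ i → sym (+-suc k (suc (toℕ i))))))

∅-reaches-flipped : ∀ k (v : SparseView {m} S) → flipped k ∅-view ∼ flipped k v
∅-reaches-flipped k []                  = ε
∅-reaches-flipped k (outside∷ v)        = gmap (suc k ∷_) there (∅-reaches-flipped (suc k) v)
∅-reaches-flipped k [inside]            = here (inj₂ refl) ◅ ε
∅-reaches-flipped k (inside∷outside∷ v) =
  here (inj₂ refl) ◅ gmap (λ w → suc (suc k) ∷ suc k ∷ w) (λ s → there (there s))
                          (∅-reaches-flipped (suc (suc k)) v)

flipped∈class : (v : SparseView {m} S) → InIdClass (flipped 0 v)
flipped∈class {m} v = subst (_∼ flipped 0 v) (flipped-∅ 0 m) (∅-reaches-flipped 0 v)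

IsFlipped : ℕ → Word (suc m) → Set
IsFlipped {m} k w = Σ[ S ∈ Subset m ] Σ[ v ∈ SparseView S ] w ≡ flipped k v

step-flipped : ∀ k (v : SparseView {m} S) {w} → Step (flipped k v) w → IsFlipped k w
step-flipped k []                                     (there ())
step-flipped k (outside∷ [])                          (here _) = _ , [inside] , refl
step-flipped k (outside∷ outside∷ v)                  (here _) = _ , inside∷outside∷ v , refl
step-flipped k (outside∷ [inside])                    (here (inj₁ ()))
step-flipped k (outside∷ [inside])                    (here (inj₂ ()))
step-flipped k (outside∷ inside∷outside∷ v)           (here (inj₁ ()))
step-flipped k (outside∷ inside∷outside∷ v)           (here (inj₂ ()))
step-flipped k (outside∷ v)                           (there s)
  with step-flipped (suc k) v s
... | _ , v′ , refl = _ , outside∷ v′ , refl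
step-flipped k [inside]                               (here _) = _ , outside∷ [] , refl
step-flipped k [inside]                               (there (there ()))
step-flipped k (inside∷outside∷ v)                    (here _) = _ , outside∷ outside∷ v , refl
step-flipped k (inside∷outside∷ [])                   (there (here (inj₁ ())))
step-flipped k (inside∷outside∷ [])                   (there (here (inj₂ ())))
step-flipped k (inside∷outside∷ (outside∷ v))         (there (here (inj₁ ())))
step-flipped k (inside∷outside∷ (outside∷ v))         (there (here (inj₂ ())))
step-flipped k (inside∷outside∷ [inside])             (there (here (inj₁ ())))
step-flipped k (inside∷outside∷ [inside])             (there (here (inj₂ ())))
step-flipped k (inside∷outside∷ (inside∷outside∷ v)) (there (here (inj₁ ())))
step-flipped k (inside∷outside∷ (inside∷outside∷ v)) (there (here (inj₂ ())))
step-flipped k (inside∷outside∷ v)                    (there (there s))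
  with step-flipped (suc (suc k)) v s
... | _ , v′ , refl = _ , inside∷outside∷ v′ , refl

∼-flipped : ∀ k (v : SparseView {m} S) {w} → flipped k v ∼ w → IsFlipped k w
∼-flipped k v ε = _ , v , refl
∼-flipped k v (s ◅ ss) with step-flipped k v s
... | _ , v′ , refl = ∼-flipped k v′ ss

class⇒flipped : {w : Word (suc m)} → InIdClass w → IsFlipped 0 w
class⇒flipped {m} c = ∼-flipped 0 ∅-view (subst (_∼ _) (sym (flipped-∅ 0 m)) c)

descentSet-ascent : ∀ {a} (w : Word (suc m)) → a < head w →
                    descentSet (a ∷ w) ≡ outside ∷ descentSet w
descentSet-ascent {a = a} (b ∷ w) a<b =
  cong (λ d → (if d then inside else outside) ∷ descentSet (b ∷ w))
       (dec-false (b <? a) (<-asym a<b))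

descentSet-descent : ∀ {a} (w : Word (suc m)) → head w < a →
                     descentSet (a ∷ w) ≡ inside ∷ descentSet w
descentSet-descent {a = a} (b ∷ w) b<a =
  cong (λ d → (if d then inside else outside) ∷ descentSet (b ∷ w))
       (dec-true (b <? a) b<a)

head-flipped : ∀ k (v : SparseView {m} S) → k < head (flipped k v)
head-flipped k []                  = n<1+n k
head-flipped k (outside∷ v)        = n<1+n k
head-flipped k [inside]            = <⇒≤ (n<1+n (suc k))
head-flipped k (inside∷outside∷ v) = <⇒≤ (n<1+n (suc k))

descentSet-flipped : ∀ k (v : SparseView {m} S) → descentSet (flipped k v) ≡ S
descentSet-flipped k []                  = refl
descentSet-flipped k (outside∷ v)        =
  trans (descentSet-ascent (flipped (suc k) v) (head-flipped (suc k) v))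
        (cong (outside ∷_) (descentSet-flipped (suc k) v))
descentSet-flipped k [inside]            = descentSet-descent (suc k ∷ []) (n<1+n (suc k))
descentSet-flipped k (inside∷outside∷ v) =
  trans (descentSet-descent (suc k ∷ flipped (suc (suc k)) v) (n<1+n (suc k)))
        (cong (inside ∷_)
          (trans (descentSet-ascent (flipped (suc (suc k)) v)
                                    (<⇒≤ (head-flipped (suc (suc k)) v)))
                 (cong (outside ∷_) (descentSet-flipped (suc (suc k)) v))))

flipped-determined : ∀ k {T : Subset m} (v : SparseView S) (v′ : SparseView T) →
                     S ≡ T → flipped k v ≡ flipped k v′
flipped-determined k v v′ refl = cong (flipped k) (sparseView-irrelevant v v′)

lemma3p1 : (m : ℕ) →
    ((S : Subset m) → Sparse S →
       ∃! _≡_ (λ (w : Word (suc m)) → InIdClass w × descentSet w ≡ S))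
    × ((w : Word (suc m)) → InIdClass w → Sparse (descentSet w))
lemma3p1 m = unique-word , descents-sparse
  where
  descents-sparse : (w : Word (suc m)) → InIdClass w → Sparse (descentSet w)
  descents-sparse w c with class⇒flipped c
  ... | _ , v , refl = subst Sparse (sym (descentSet-flipped 0 v)) (view⇒sparse v)

  unique-word : (S : Subset m) → Sparse S →
                ∃! _≡_ (λ (w : Word (suc m)) → InIdClass w × descentSet w ≡ S)
  unique-word S sp = flipped 0 v , (flipped∈class v , descentSet-flipped 0 v) , unique
    where
    v : SparseView S
    v = sparse⇒view S sp
    unique : ∀ {w} → InIdClass w × descentSet w ≡ S → flipped 0 v ≡ w
    unique (c , D≡S) with class⇒flipped c
    ... | _ , v′ , refl =
      flipped-determined 0 v v′ (sym (trans (sym (descentSet-flipped 0 v′)) D≡S))
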